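{- If a finite simple graph $G$ admits a split divide, then there is a composable pair $(G_1,G_2)$ such that $G$ is the split unification of $(G_1,G_2)$, where each of $G_1$ and $G_2$ has strictly fewer vertices than $G$ and is isomorphic to an induced subgraph of $G$.
   Context: For $S\subseteq V(G)$ and $v\notin S$: $v$ is complete to $S$ if adjacent to all of $S$, anticomplete if adjacent to none, mixed on $S$ otherwise; a set is complete (anticomplete) to a disjoint set if each of its vertices is. An anticomponent of $S$ is a subset of $S$ inducing a connected component of the complement of $G[S]$. A split divide of $G$ is a partition $(A,B,C,L,T)$ of $V(G)$ (where $B,T$ may be empty) such that: $|A|\ge 2$, $A$ is complete to $B$ and anticomplete to $C\cup T$, and some vertex of $A$ is complete to $L$; $L$ is a non-empty clique, every vertex of $L$ is mixed on $A$, and $L$ is complete to $B\cup C$; $|C|\ge 2$, some vertex of $C$ is complete to $B$, and no vertex of $C$ is mixed on any anticomponent of $B$; $T$ is a (possibly empty) stable set anticomplete to $C$. Composable pair: let $A,B,C,L,T$ be pairwise disjoint sets with $A,C$ non-empty, and $a^*,c^*$ two distinct vertices not in $A\cup B\cup C\cup L\cup T$. $G_1$ is a graph on $A\cup B\cup L\cup T\cup\{c^*\}$ such that $L$ is a (possibly empty) clique, $T$ is a (possibly empty) stable set, $A$ is complete to $B$ and anticomplete to $T$, some vertex of $A$ is complete to $L$, and $c^*$ is complete to $B\cup L$ and anticomplete to $A\cup T$ (other adjacencies arbitrary). $G_2$ is a graph on $B\cup C\cup L\cup T\cup\{a^*\}$ such that $G_2[B\cup L\cup T]=G_1[B\cup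 L\cup T]$, $T$ is anticomplete to $C$, $L$ is complete to $B\cup C$, $a^*$ is complete to $B\cup L$ and anticomplete to $C\cup T$, some vertex of $C$ is complete to $B$, and no vertex of $C$ is mixed on any anticomponent of $B$ (other adjacencies arbitrary). Then $(G_1,G_2)$ is a composable pair. Its split unification is the graph $G$ on $A\cup B\cup C\cup L\cup T$ with $G[A\cup B\cup L\cup T]=G_1\setminus c^*$, $G[B\cup C\cup L\cup T]=G_2\setminus a^*$, and $A$ anticomplete to $C$. -}

module Defs where

open import Level using (0ℓ)
open import Data.Nat using (ℕ; zero; suc; _+_)
open import Data.Fin using (Fin; zero; suc)
open import Data.Bool using (Bool; true; false)
open import Data.Sum using (_⊎_; inj₁; inj₂)
open import Data.Product using (Σ; ∃; ∃₂; _×_; _,_)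
open import Data.Empty using (⊥)
open import Data.Unit using (⊤)
open import Relation.Binary.PropositionalEquality using (_≡_; _≢_)
open import Relation.Nullary using (¬_)
open import Relation.Unary using (Pred; _∪_)

record SGraph (U : Set) : Set where
  field
    adj    : U → U → Bool
    sym    : ∀ u v → adj u v ≡ adj v u
    irrefl : ∀ v → adj v v ≡ false

Graph : ℕ → Set
Graph n = SGraph (Fin n)

Set′ : Set → Set₁
Set′ U = Pred U 0ℓ

module _ {U : Set} (G : SGraph U) where
  open SGraph G

  CompleteTo : U → Set′ U → Set
  CompleteTo v S = ∀ s → S s → adj v s ≡ true

  AnticompleteTo : U → Set′ U → Set
  AnticompleteTo v S = ∀ s → S s → adj v s ≡ false

  MixedOn : U → Set′ U → Set
  MixedOn v S = (∃ λ s → S s × adj v s ≡ true) × (∃ λ s → S s × adj v s ≡ false)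

  SetComplete : Set′ U → Set′ U → Set
  SetComplete R S = ∀ r → R r → CompleteTo r S

  SetAnticomplete : Set′ U → Set′ U → Set
  SetAnticomplete R S = ∀ r → R r → AnticompleteTo r S

  Clique : Set′ U → Set
  Clique S = ∀ u v → S u → S v → u ≢ v → adj u v ≡ true

  Stable : Set′ U → Set
  Stable S = ∀ u v → S u → S v → adj u v ≡ false

  -- AntiReach S x y : y is reachable from x in the complement of G[S]
  data AntiReach (S : Set′ U) (x : U) : U → Set where
    here : S x → AntiReach S x x
    step : ∀ {y z} → AntiReach S x y → S z → y ≢ z → adj y z ≡ false →
           AntiReach S x z

  IsAnticomponent : Set′ U → Set′ U → Set
  IsAnticomponent S X =
    ∃ λ x → S x × (∀ y → (X y → AntiReach S x y) × (AntiReach S x y → X y))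

  NoMixedOnAnticomponents : Set′ U → Set′ U → Set₁
  NoMixedOnAnticomponents C B =
    ∀ c → C c → ∀ (X : Set′ U) → IsAnticomponent B X → ¬ MixedOn c X

  AtLeastTwo : Set′ U → Set
  AtLeastTwo S = ∃₂ λ x y → x ≢ y × S x × S y

  NonEmpty : Set′ U → Set
  NonEmpty S = ∃ λ x → S x

-- A 5-part partition (A,B,C,L,T) of a vertex type (parts may a priori be
-- empty) is given by a labelling function.

data Part : Set where
  pA pB pC pL pT : Part

Cls : ∀ {n} → (Fin n → Part) → Part → Set′ (Fin n)
Cls lab X v = lab v ≡ X

record IsSplitDivide {n : ℕ} (G : Graph n) (lab : Fin n → Part) : Set₁ where
  A = Cls lab pA
  B = Cls lab pB
  C = Cls lab pC
  L = Cls lab pL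
  T = Cls lab pT
  field
    A≥2          : AtLeastTwo G A
    A-B          : SetComplete G A B
    A-CT         : SetAnticomplete G A (C ∪ T)
    A→L          : ∃ λ a → A a × CompleteTo G a L
    L-nonempty   : NonEmpty G L
    L-clique     : Clique G L
    L-mixed      : ∀ l → L l → MixedOn G l A
    L-BC         : SetComplete G L (B ∪ C)
    C≥2          : AtLeastTwo G C
    C→B          : ∃ λ c → C c × CompleteTo G c B
    C-B-nomix    : NoMixedOnAnticomponents G C B
    T-stable     : Stable G T
    T-C          : SetAnticomplete G T C

SplitDivide : ∀ {n} → Graph n → Set₁
SplitDivide {n} G = Σ (Fin n → Part) (IsSplitDivide G)

-- The sets A,B,C,L,T of the pair partition Fin n
-- (the vertex set of the split unification) via a labelling; the two
-- extra vertices a*, c* are the two elements of Extra.  G₁ and G₂ are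
-- simple graphs on Fin n ⊎ Extra; G₁'s vertex set is A∪B∪L∪T∪{c*} and
-- G₂'s vertex set is B∪C∪L∪T∪{a*} (adjacencies outside these vertex
-- sets are irrelevant).

data Extra : Set where
  a* c* : Extra

U⁺ : ℕ → Set
U⁺ n = Fin n ⊎ Extra

Cls⁺ : ∀ {n} → (Fin n → Part) → Part → Set′ (U⁺ n)
Cls⁺ lab X (inj₁ v) = lab v ≡ X
Cls⁺ lab X (inj₂ _) = ⊥

inV₁ : ∀ {n} → (Fin n → Part) → U⁺ n → Bool
inV₁ lab (inj₁ v) with lab v
... | pA = true
... | pB = true
... | pC = false
... | pL = true
... | pT = true
inV₁ lab (inj₂ a*) = false
inV₁ lab (inj₂ c*) = true

inV₂ : ∀ {n} → (Fin n → Part) → U⁺ n → Bool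
inV₂ lab (inj₁ v) with lab v
... | pA = false
... | pB = true
... | pC = true
... | pL = true
... | pT = true
inV₂ lab (inj₂ a*) = true
inV₂ lab (inj₂ c*) = false

b2n : Bool → ℕ
b2n true  = 1
b2n false = 0

countFin : ∀ {n} → (Fin n → Bool) → ℕ
countFin {zero}  p = 0
countFin {suc n} p = b2n (p zero) + countFin (λ i → p (suc i))

countU : ∀ {n} → (U⁺ n → Bool) → ℕ
countU p = countFin (λ i → p (inj₁ i)) + b2n (p (inj₂ a*)) + b2n (p (inj₂ c*))

record IsComposablePair {n : ℕ} (lab : Fin n → Part)
                        (G₁ G₂ : SGraph (U⁺ n)) : Set₁ where
  open SGraph G₁ renaming (adj to adj₁)
  open SGraph G₂ renaming (adj to adj₂)
  A = Cls⁺ lab pA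
  B = Cls⁺ lab pB
  C = Cls⁺ lab pC
  L = Cls⁺ lab pL
  T = Cls⁺ lab pT
  a⋆ : U⁺ n
  a⋆ = inj₂ a*
  c⋆ : U⁺ n
  c⋆ = inj₂ c*
  field
    A-nonempty : NonEmpty G₁ A
    C-nonempty : NonEmpty G₂ C
    G₁-L-clique  : Clique G₁ L
    G₁-T-stable  : Stable G₁ T
    G₁-A-B       : SetComplete G₁ A B
    G₁-A-T       : SetAnticomplete G₁ A T
    G₁-A→L       : ∃ λ a → A a × CompleteTo G₁ a L
    G₁-c*-BL     : CompleteTo G₁ c⋆ (B ∪ L)
    G₁-c*-AT     : AnticompleteTo G₁ c⋆ (A ∪ T)
    G₂-agree     : ∀ u v → (B ∪ L ∪ T) u → (B ∪ L ∪ T) v → adj₂ u v ≡ adj₁ u v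
    G₂-T-C       : SetAnticomplete G₂ T C
    G₂-L-BC      : SetComplete G₂ L (B ∪ C)
    G₂-a*-BL     : CompleteTo G₂ a⋆ (B ∪ L)
    G₂-a*-CT     : AnticompleteTo G₂ a⋆ (C ∪ T)
    G₂-C→B       : ∃ λ c → C c × CompleteTo G₂ c B
    G₂-C-B-nomix : NoMixedOnAnticomponents G₂ C B

-- G (on Fin n = A∪B∪C∪L∪T) is the split unification of (G₁,G₂):
-- G[A∪B∪L∪T] = G₁ ∖ c*, G[B∪C∪L∪T] = G₂ ∖ a*, and A anticomplete to C.
record IsSplitUnification {n : ℕ} (G : Graph n) (lab : Fin n → Part)
                          (G₁ G₂ : SGraph (U⁺ n)) : Set where
  open SGraph G
  open SGraph G₁ renaming (adj to adj₁)
  open SGraph G₂ renaming (adj to adj₂)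
  field
    on-ABLT : ∀ u v → lab u ≢ pC → lab v ≢ pC → adj u v ≡ adj₁ (inj₁ u) (inj₁ v)
    on-BCLT : ∀ u v → lab u ≢ pA → lab v ≢ pA → adj u v ≡ adj₂ (inj₁ u) (inj₁ v)
    A-C     : ∀ u v → lab u ≡ pA → lab v ≡ pC → adj u v ≡ false

IsoToInducedSubgraph : ∀ {U : Set} {n} → SGraph U → (U → Bool) → Graph n → Set
IsoToInducedSubgraph {U} {n} H inV G =
  ∃ λ (f : U → Fin n) →
    (∀ u v → inV u ≡ true → inV v ≡ true → f u ≡ f v → u ≡ v) ×
    (∀ u v → inV u ≡ true → inV v ≡ true →
       SGraph.adj G (f u) (f v) ≡ SGraph.adj H u v)

-- A single graph serves as both G₁ and G₂ (each only matters on its own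
-- vertex set): G itself, with the marker a* played by a vertex a₀ ∈ A complete to L and c* by a vertex c₀ ∈ C complete to B: a₀ is
-- complete to B ∪ L and anticomplete to C ∪ T, and c₀ is complete to B ∪ L
-- and anticomplete to A ∪ T, exactly as the markers must be.  So G₁ is G
-- induced on A ∪ B ∪ L ∪ T ∪ {c₀} and G₂ is G induced on B ∪ C ∪ L ∪ T ∪ {a₀};
-- they miss at least one vertex of C (resp. A) since |A|, |C| ≥ 2.  The one
-- condition that is not inherited pointwise, that no vertex of C is mixed on
-- an anticomponent of B, survives because the anticomponents of B do not
-- involve the markers.
module Submission where

open import Defs
open import Data.Nat using (ℕ; zero; suc; _+_; _≤_; _<_; z≤n; s≤s)
open import Data.Nat.Properties
  using (≤-refl; m≤n⇒m≤1+n; +-assoc; +-comm; +-monoʳ-≤; module ≤-Reasoning)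
open import Data.Fin using (Fin; zero; suc)
open import Data.Bool using (Bool; true; false)
open import Data.Product using (Σ; ∃; ∃₂; _×_; _,_; proj₁; proj₂)
open import Data.Sum using (_⊎_; inj₁; inj₂; [_,_])
open import Data.Sum.Properties using (inj₁-injective)
open import Data.Empty using (⊥-elim)
open import Function using (id; _∘_)
open import Relation.Binary.PropositionalEquality using (_≡_; _≢_; refl; cong; trans)
open import Relation.Nullary using (¬_)

countFin≤ : ∀ {n} (p : Fin n → Bool) → countFin p ≤ n
countFin≤ {zero}  p = z≤n
countFin≤ {suc n} p with p zero
... | true  = s≤s (countFin≤ (p ∘ suc))
... | false = m≤n⇒m≤1+n (countFin≤ (p ∘ suc))

countFin< : ∀ {n} (p : Fin n → Bool) {x} → p x ≡ false → countFin p < n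
countFin< {suc n} p {zero} px rewrite px = s≤s (countFin≤ (p ∘ suc))
countFin< {suc n} p {suc x} px with p zero | countFin< (p ∘ suc) px
... | true  | ih = s≤s ih
... | false | ih = m≤n⇒m≤1+n ih

2+countFin≤ : ∀ {n} (p : Fin n → Bool) {x y} → x ≢ y →
              p x ≡ false → p y ≡ false → 2 + countFin p ≤ n
2+countFin≤ p {zero} {zero} x≢y _ _ = ⊥-elim (x≢y refl)
2+countFin≤ {suc n} p {zero} {suc y} _ px py rewrite px = s≤s (countFin< (p ∘ suc) py)
2+countFin≤ {suc n} p {suc x} {zero} _ px py rewrite py = s≤s (countFin< (p ∘ suc) px)
2+countFin≤ {suc n} p {suc x} {suc y} x≢y px py
  with p zero | 2+countFin≤ (p ∘ suc) (x≢y ∘ cong suc) px py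
... | true  | ih = s≤s ih
... | false | ih = m≤n⇒m≤1+n ih

countU<n : ∀ {n} (p : U⁺ n → Bool) → b2n (p (inj₂ a*)) + b2n (p (inj₂ c*)) ≤ 1 →
           ∀ {x y} → x ≢ y → p (inj₁ x) ≡ false → p (inj₁ y) ≡ false → countU p < n
countU<n {n} p extras≤1 x≢y px py = begin-strict
  c + a + b    ≡⟨ +-assoc c a b ⟩
  c + (a + b)  ≤⟨ +-monoʳ-≤ c extras≤1 ⟩
  c + 1        ≡⟨ +-comm c 1 ⟩
  suc c        <⟨ 2+countFin≤ (p ∘ inj₁) x≢y px py ⟩
  n            ∎
  where
  open ≤-Reasoning
  c = countFin (p ∘ inj₁)
  a = b2n (p (inj₂ a*))
  b = b2n (p (inj₂ c*))

inV₁-C : ∀ {n} (lab : Fin n → Part) {u} → lab u ≡ pC → inV₁ lab (inj₁ u) ≡ false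
inV₁-C lab lu rewrite lu = refl

inV₂-A : ∀ {n} (lab : Fin n → Part) {u} → lab u ≡ pA → inV₂ lab (inj₁ u) ≡ false
inV₂-A lab lu rewrite lu = refl

pullback : {U V : Set} → (U → V) → SGraph V → SGraph U
pullback f G = record
  { adj    = λ u v → SGraph.adj G (f u) (f v)
  ; sym    = λ u v → SGraph.sym G (f u) (f v)
  ; irrefl = λ u → SGraph.irrefl G (f u) }

InjectiveOn : {U V : Set} → (U → Bool) → (U → V) → Set
InjectiveOn W f = ∀ u v → W u ≡ true → W v ≡ true → f u ≡ f v → u ≡ v

pullback-isoToInducedSubgraph : ∀ {U n} (G : Graph n) (W : U → Bool) {f : U → Fin n} →
  InjectiveOn W f → IsoToInducedSubgraph (pullback f G) W G
pullback-isoToInducedSubgraph G W {f} f-inj = f , f-inj , λ _ _ _ _ → refl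

module _ {V E : Set} (ε : E → V) where

  private
    true≡false-elim : ∀ {b} → b ≡ true → b ≡ false → ∀ {A : Set} → A
    true≡false-elim refl ()

  [id,ε]-injectiveOn : (W : V ⊎ E → Bool) →
    (∀ e e′ → W (inj₂ e) ≡ true → W (inj₂ e′) ≡ true → e ≡ e′) →
    (∀ e → W (inj₂ e) ≡ true → W (inj₁ (ε e)) ≡ false) →
    InjectiveOn W [ id , ε ]
  [id,ε]-injectiveOn W _ _ (inj₁ u) (inj₁ v) _ _ u≡v = cong inj₁ u≡v
  [id,ε]-injectiveOn W _ ε∉W (inj₁ u) (inj₂ e) Wu We refl = true≡false-elim Wu (ε∉W e We)
  [id,ε]-injectiveOn W _ ε∉W (inj₂ e) (inj₁ v) We Wv refl = true≡false-elim Wv (ε∉W e We)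
  [id,ε]-injectiveOn W unique _ (inj₂ e) (inj₂ e′) We We′ _ = cong inj₂ (unique e e′ We We′)

AntiReach-target : ∀ {U} {G : SGraph U} {S x y} → AntiReach G S x y → S y
AntiReach-target (here s)       = s
AntiReach-target (step _ s _ _) = s

module _ {V E : Set} (G : SGraph V) (ε : E → V) {S : Set′ (V ⊎ E)}
         (S-old : ∀ e → ¬ S (inj₂ e)) where

  private
    H = pullback [ id , ε ] G

  AntiReach-restrict : ∀ {x y} → AntiReach H S (inj₁ x) (inj₁ y) → AntiReach G (S ∘ inj₁) x y
  AntiReach-restrict (here s) = here s
  AntiReach-restrict (step {inj₁ _} {inj₁ _} r s y≢z y≁z) =
    step (AntiReach-restrict r) s (y≢z ∘ cong inj₁) y≁z
  AntiReach-restrict (step {inj₂ e} r _ _ _) = ⊥-elim (S-old e (AntiReach-target r))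

  AntiReach-extend : ∀ {x y} → AntiReach G (S ∘ inj₁) x y → AntiReach H S (inj₁ x) (inj₁ y)
  AntiReach-extend (here s) = here s
  AntiReach-extend (step r s y≢z y≁z) =
    step (AntiReach-extend r) s (y≢z ∘ inj₁-injective) y≁z

  IsAnticomponent-restrict : ∀ {X} → IsAnticomponent H S X →
    IsAnticomponent G (S ∘ inj₁) (X ∘ inj₁) × (∀ e → ¬ X (inj₂ e))
  IsAnticomponent-restrict (inj₂ e , s , _) = ⊥-elim (S-old e s)
  IsAnticomponent-restrict (inj₁ x , s , X≡reach) =
      (x , s , λ y → AntiReach-restrict ∘ proj₁ (X≡reach (inj₁ y))
                   , proj₂ (X≡reach (inj₁ y)) ∘ AntiReach-extend)
    , λ e Xe → S-old e (AntiReach-target (proj₁ (X≡reach (inj₂ e)) Xe))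

NoMixedOnAnticomponents-pullback : ∀ {V E : Set} (G : SGraph V) (ε : E → V)
  {B C : Set′ (V ⊎ E)} → (∀ e → ¬ B (inj₂ e)) → (∀ e → ¬ C (inj₂ e)) →
  NoMixedOnAnticomponents G (C ∘ inj₁) (B ∘ inj₁) →
  NoMixedOnAnticomponents (pullback [ id , ε ] G) C B
NoMixedOnAnticomponents-pullback G ε B-old C-old nomix (inj₂ e) Ce _ _ _ = C-old e Ce
NoMixedOnAnticomponents-pullback G ε B-old C-old nomix (inj₁ c) Cc X X-anti
  ((s , Xs , c~s) , (s′ , Xs′ , c≁s′)) =
  nomix c Cc (X ∘ inj₁) X-anti′ (restrict s Xs c~s , restrict s′ Xs′ c≁s′)
  where
  X-anti′ = proj₁ (IsAnticomponent-restrict G ε B-old X-anti)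
  restrict : ∀ {b} s → X s → SGraph.adj G c ([ id , ε ] s) ≡ b →
             ∃ λ v → X (inj₁ v) × SGraph.adj G c v ≡ b
  restrict (inj₁ v) Xv c~v = v , Xv , c~v
  restrict (inj₂ e) Xe _   = ⊥-elim (proj₂ (IsAnticomponent-restrict G ε B-old X-anti) e Xe)

module _ {n : ℕ} {G : Graph n} {lab : Fin n → Part} (sd : IsSplitDivide G lab) where
  open IsSplitDivide sd
  open SGraph G using (adj)

  private
    a₀ = proj₁ A→L
    a₀∈A = proj₁ (proj₂ A→L)
    a₀-L = proj₂ (proj₂ A→L)
    c₀ = proj₁ C→B
    c₀∈C = proj₁ (proj₂ C→B)
    c₀-B = proj₂ (proj₂ C→B)

    marker : Extra → Fin n
    marker a* = a₀
    marker c* = c₀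

    adj-flip : ∀ {u v b} → adj u v ≡ b → adj v u ≡ b
    adj-flip {u} {v} u~v = trans (SGraph.sym G v u) u~v

  piece : SGraph (U⁺ n)
  piece = pullback [ id , marker ] G

  piece-isComposablePair : IsComposablePair lab piece piece
  piece-isComposablePair = record
    { A-nonempty = let (x , _ , _ , x∈A , _) = A≥2 in inj₁ x , x∈A
    ; C-nonempty = let (x , _ , _ , x∈C , _) = C≥2 in inj₁ x , x∈C
    ; G₁-L-clique = λ { (inj₁ u) (inj₁ v) u∈L v∈L u≢v → L-clique u v u∈L v∈L (u≢v ∘ cong inj₁) }
    ; G₁-T-stable = λ { (inj₁ u) (inj₁ v) → T-stable u v }
    ; G₁-A-B = λ { (inj₁ u) u∈A (inj₁ v) → A-B u u∈A v }
    ; G₁-A-T = λ { (inj₁ u) u∈A (inj₁ v) v∈T → A-CT u u∈A v (inj₂ v∈T) }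
    ; G₁-A→L = inj₁ a₀ , a₀∈A , λ { (inj₁ v) → a₀-L v }
    ; G₁-c*-BL = λ { (inj₁ v) (inj₁ v∈B) → c₀-B v v∈B
                   ; (inj₁ v) (inj₂ v∈L) → adj-flip (L-BC v v∈L c₀ (inj₂ c₀∈C)) }
    ; G₁-c*-AT = λ { (inj₁ v) (inj₁ v∈A) → adj-flip (A-CT v v∈A c₀ (inj₁ c₀∈C))
                   ; (inj₁ v) (inj₂ v∈T) → adj-flip (T-C v v∈T c₀ c₀∈C) }
    ; G₂-agree = λ _ _ _ _ → refl
    ; G₂-T-C = λ { (inj₁ u) u∈T (inj₁ v) → T-C u u∈T v }
    ; G₂-L-BC = λ { (inj₁ u) u∈L (inj₁ v) (inj₁ v∈B) → L-BC u u∈L v (inj₁ v∈B)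
                  ; (inj₁ u) u∈L (inj₁ v) (inj₂ v∈C) → L-BC u u∈L v (inj₂ v∈C) }
    ; G₂-a*-BL = λ { (inj₁ v) (inj₁ v∈B) → A-B a₀ a₀∈A v v∈B
                   ; (inj₁ v) (inj₂ v∈L) → a₀-L v v∈L }
    ; G₂-a*-CT = λ { (inj₁ v) (inj₁ v∈C) → A-CT a₀ a₀∈A v (inj₁ v∈C)
                   ; (inj₁ v) (inj₂ v∈T) → A-CT a₀ a₀∈A v (inj₂ v∈T) }
    ; G₂-C→B = inj₁ c₀ , c₀∈C , λ { (inj₁ v) → c₀-B v }
    ; G₂-C-B-nomix = NoMixedOnAnticomponents-pullback G marker (λ _ ()) (λ _ ()) C-B-nomix
    }

  piece-isSplitUnification : IsSplitUnification G lab piece piece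
  piece-isSplitUnification = record
    { on-ABLT = λ _ _ _ _ → refl
    ; on-BCLT = λ _ _ _ _ → refl
    ; A-C     = λ u v u∈A v∈C → A-CT u u∈A v (inj₁ v∈C) }

  count₁<n : countU (inV₁ lab) < n
  count₁<n = let (x , y , x≢y , x∈C , y∈C) = C≥2 in
    countU<n (inV₁ lab) ≤-refl x≢y (inV₁-C lab x∈C) (inV₁-C lab y∈C)

  count₂<n : countU (inV₂ lab) < n
  count₂<n = let (x , y , x≢y , x∈A , y∈A) = A≥2 in
    countU<n (inV₂ lab) ≤-refl x≢y (inV₂-A lab x∈A) (inV₂-A lab y∈A)

  piece-iso₁ : IsoToInducedSubgraph piece (inV₁ lab) G
  piece-iso₁ = pullback-isoToInducedSubgraph G (inV₁ lab)
    ([id,ε]-injectiveOn marker (inV₁ lab)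
      (λ { c* c* _ _ → refl ; a* _ () _ ; c* a* _ () })
      (λ { c* _ → inV₁-C lab c₀∈C ; a* () }))

  piece-iso₂ : IsoToInducedSubgraph piece (inV₂ lab) G
  piece-iso₂ = pullback-isoToInducedSubgraph G (inV₂ lab)
    ([id,ε]-injectiveOn marker (inV₂ lab)
      (λ { a* a* _ _ → refl ; c* _ () _ ; a* c* _ () })
      (λ { a* _ → inV₂-A lab a₀∈A ; c* () }))

theorem4p1 : (n : ℕ) (G : Graph n) → SplitDivide G →
    Σ (Fin n → Part) λ lab → ∃₂ λ (G₁ G₂ : SGraph (U⁺ n)) →
      IsComposablePair lab G₁ G₂ ×
      IsSplitUnification G lab G₁ G₂ ×
      countU (inV₁ lab) < n × countU (inV₂ lab) < n ×
      IsoToInducedSubgraph G₁ (inV₁ lab) G ×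
      IsoToInducedSubgraph G₂ (inV₂ lab) G
theorem4p1 n G (lab , sd) =
  lab , piece sd , piece sd ,
  piece-isComposablePair sd , piece-isSplitUnification sd ,
  count₁<n sd , count₂<n sd , piece-iso₁ sd , piece-iso₂ sd
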